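{- Let $k\ge2$ and $f\ge1$ be integers, let $F$ be a $k$-partite $k$-graph with $|V(F)|=f$, and let $0<p,\omega<1$. There exists $\mu_0>0$ such that for every $0<\mu\le\mu_0$ there exists $n_0$ such that for all $n\ge n_0$: if $H$ is a $(p,\mu)$-dense $k$-partite $k$-graph with each part having $n$ vertices, then there exists an $F$-tiling in $H$ that covers all but at most $\omega n$ vertices in each part of $H$.
   Context: A $k$-graph $H$ is $k$-partite with parts $V_1,\dots,V_k$ if every edge meets each $V_i$ in at most one vertex. For $0<p,\mu<1$, $H$ with $N=|V(H)|$ vertices is $(p,\mu)$-dense if for all $X_i\subseteq V_i$, $e_H(X_1,\dots,X_k)\ge p|X_1|\cdots|X_k|-\mu N^k$, where $e_H(X_1,\dots,X_k)$ counts $(x_1,\dots,x_k)\in X_1\times\cdots\times X_k$ with $\{x_1,\dots,x_k\}\in E(H)$. An $F$-tiling in $H$ is a set of vertex-disjoint copies of $F$ in $H$.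
   Formalization: The parameters p, ω and μ range over the rationals, and the threshold μ₀ is taken in the rationals. -}

module Defs where

open import Data.Nat as ℕ using (ℕ; zero; suc; _≥_)
open import Data.Integer using (+_)
open import Data.Rational as ℚ using (ℚ; _/_)
open import Data.Bool using (Bool; true; false; _∧_)
open import Data.Fin using (Fin; zero; suc; _≟_)
open import Data.Fin.Subset using (Subset; ∣_∣)
open import Data.Fin.Properties using (any?)
open import Data.Vec using (lookup)
open import Data.List using (List; []; _∷_; map; concatMap; filter; length; allFin)
open import Data.Bool.ListAction using (all)
open import Data.Nat.ListAction using (product)
open import Data.List.Membership.Propositional using (_∈_)
open import Data.Product using (Σ; ∃; _×_; _,_; proj₁; proj₂)
open import Data.Product.Properties using (≡-dec)
open import Relation.Nullary using (¬?; Dec; does)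
open import Relation.Binary.PropositionalEquality using (_≡_)
open import Function.Definitions using (Injective)

ℕ→ℚ : ℕ → ℚ
ℕ→ℚ n = + n / 1

_◂_ : ∀ {k n} → Fin n → (Fin k → Fin n) → Fin (suc k) → Fin n
(a ◂ g) zero    = a
(a ◂ g) (suc i) = g i

allTuples : (k n : ℕ) → List (Fin k → Fin n)
allTuples zero    n = (λ ()) ∷ []
allTuples (suc k) n = concatMap (λ a → map (λ g → a ◂ g) (allTuples k n)) (allFin n)

-- The host graph H: a k-partite k-graph with parts V_1..V_k, each of
-- size n.  Vertex (i , v) is the v-th vertex of part V_i.  Since H is a
-- k-partite k-graph, every edge contains exactly one vertex of each part,
-- so an edge is determined by a tuple x : Fin k → Fin n, namely the edge
-- {(i , x i) : i ∈ Fin k}.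

PartiteKGraph : (k n : ℕ) → Set
PartiteKGraph k n = (Fin k → Fin n) → Bool

Vertex : (k n : ℕ) → Set
Vertex k n = Fin k × Fin n

eH : ∀ {k n} → PartiteKGraph k n → (Fin k → Subset n) → ℕ
eH {k} {n} H X =
  length (filter (λ x → Data.Bool._≟_ (all (λ i → lookup (X i) (x i)) (allFin k) ∧ H x) true)
                 (allTuples k n))
  where import Data.Bool

-- (p , μ)-dense, with N = |V(H)| = k n:
-- for all X_i ⊆ V_i, e_H(X_1,…,X_k) ≥ p |X_1|⋯|X_k| − μ N^k
Dense : ∀ {k n} → ℚ → ℚ → PartiteKGraph k n → Set
Dense {k} {n} p μ H =
  (X : Fin k → Subset n) →
  p ℚ.* ℕ→ℚ (product (map (λ i → ∣ X i ∣) (allFin k))) ℚ.- μ ℚ.* ℕ→ℚ ((k ℕ.* n) ℕ.^ k)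
    ℚ.≤ ℕ→ℚ (eH H X)

-- The pattern graph F: a k-graph on vertex set Fin f.  Each edge is
-- listed as a map Fin k → Fin f enumerating its k vertices.

record KGraph (k f : ℕ) : Set where
  field
    edges : List (Fin k → Fin f)

open KGraph public

IsKPartite : ∀ {k f} → KGraph k f → Set
IsKPartite {k} {f} F =
  Σ (Fin f → Fin k) λ col →
    ∀ e → e ∈ edges F → ∀ j j′ → col (e j) ≡ col (e j′) → j ≡ j′

-- The image under φ of the F-edge e is an edge of H, i.e. the set
-- {φ (e j)} equals {(i , x i) : i} for some x with H x.
-- (Given that φ and e are injective, the k distinct vertices φ (e j) of the
-- form (i , x i) have distinct first coordinates, so they are exactly the
-- vertices of the H-edge x.)
MapsToEdge : ∀ {k n f} → PartiteKGraph k n → (Fin f → Vertex k n) → (Fin k → Fin f) → Set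
MapsToEdge {k} {n} H φ e =
  Σ (Fin k → Fin n) λ x → (H x ≡ true) × (∀ j → proj₂ (φ (e j)) ≡ x (proj₁ (φ (e j))))

IsCopy : ∀ {k n f} → KGraph k f → PartiteKGraph k n → (Fin f → Vertex k n) → Set
IsCopy F H φ = Injective _≡_ _≡_ φ × (∀ e → e ∈ edges F → MapsToEdge H φ e)

record Tiling {k n f} (F : KGraph k f) (H : PartiteKGraph k n) : Set where
  field
    m      : ℕ
    copy   : Fin m → Fin f → Vertex k n
    isCopy : ∀ t → IsCopy F H (copy t)
    disjoint : ∀ t t′ a b → copy t a ≡ copy t′ b → t ≡ t′

open Tiling public

uncovered : ∀ {k n f} {F : KGraph k f} {H : PartiteKGraph k n} → Tiling F H → Fin k → ℕ
uncovered {k} {n} {f} T i =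
  length (filter (λ v → ¬? (any? (λ t → any? (λ a → ≡-dec _≟_ _≟_ (copy T t a) (i , v)))))
                 (allFin n))

-- While more than n/(1+w) vertices of every part are uncovered, the uncovered
-- vertices span a k-partite k-graph of positive density (the error term μ (kn)^k of (p, μ)-density
-- is then negligible), so by Erdős' theorem on complete k-partite k-graphs they contain a complete
-- k-partite block with f vertices in each part. Such a block is tiled exactly by k copies of F, the
-- j-th placing the colour class c of F in part c + j (mod k). Adding blocks one at a time, the
-- process ends with at most n/(1+w) ≤ ωn uncovered vertices in each part.
--
-- Erdős' theorem is proved by induction on k: by Jensen's inequality some (t+1)-tuple of distinct
-- vertices of the first part has a dense link, to which the induction hypothesis applies.

module Submission where

open import Defs
open import Data.Nat using (ℕ; zero; suc; _+_; _*_; _^_; _∸_; _%_; _≤_; _<_; _≥_; z≤n; s≤s; _≤?_; NonZero; >-nonZero)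
open import Data.Nat.Properties hiding (_≟_; ≡ᵇ⇒≡; ≡⇒≡ᵇ)
open import Data.Nat.DivMod using (_mod_; _/_; m%n<n; m≡m%n+[m/n]*n; [m+kn]%n≡m%n; [m+n]%n≡m%n; m<n⇒m%n≡m)
open import Data.Nat.Tactic.RingSolver using (solve-∀)
open import Data.Nat.ListAction using (product)
open import Data.Nat.Coprimality using (1-coprimeTo)
import Data.Nat.Coprimality as Coprimality
open import Data.Integer as ℤ using (ℤ; +[1+_]; -[1+_])
import Data.Integer.Properties as ℤₚ
open import Data.Rational as ℚ using (ℚ; mkℚ; 0ℚ; 1ℚ; NonNegative; nonNegative; toℚᵘ; *≤*; *<*)
import Data.Rational.Properties as ℚₚ
open import Data.Rational.Unnormalised as ℚᵘ using (mkℚᵘ; _≃_; *≡*)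
import Data.Rational.Unnormalised.Properties as ℚᵘₚ
open import Data.Rational.Solver using (module +-*-Solver)
open import Data.Bool as Bool using (Bool; true; false; _∧_; _∨_; not; T)
open import Data.Bool.Properties using (∧-conicalˡ; ∧-conicalʳ; ∧-assoc; not-injective; T-≡)
open import Data.Bool.ListAction using (all)
open import Data.List using (List; []; _∷_; map; concatMap; length; _++_; filter; filterᵇ; allFin; tabulate)
open import Data.List.Properties using (length-++; length-map; length-tabulate; map-tabulate)
open import Data.List.Membership.Propositional using (_∈_; find)
open import Data.List.Membership.Propositional.Properties using (∈-concatMap⁻; ∈-map⁻; ∈-allFin; ∈-filter⁻)
open import Data.List.Relation.Unary.All as All using (All; []; _∷_)
open import Data.List.Relation.Unary.Any using (here; there)
open import Data.List.Relation.Unary.Unique.Propositional using (Unique; []; _∷_)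
open import Data.List.Relation.Unary.Unique.Propositional.Properties using (allFin⁺; filter⁺)
import Data.Vec as Vec
open import Data.Vec.Properties using (lookup∘tabulate)
open import Data.Fin using (Fin; zero; suc; toℕ; _≟_; remQuot; combine)
open import Data.Fin.Properties using (any?; remQuot-combine; combine-remQuot; toℕ-fromℕ<; toℕ-injective; toℕ<n)
import Data.Fin.Properties as Finₚ
open import Data.Fin.Subset using (∣_∣)
open import Data.Product using (Σ; ∃; _×_; _,_; proj₁; proj₂; uncurry)
open import Data.Product.Properties using (×-≡,≡←≡; ×-≡,≡→≡)
open import Data.Sum using (inj₁; inj₂)
open import Data.Empty using (⊥; ⊥-elim)
open import Function using (_∘_; Injective; _⇔_; mk⇔; Equivalence)
open import Relation.Nullary using (does; yes; no; contradiction)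
open import Relation.Nullary.Decidable using (dec-true; dec-false; does-⇔; T?)
open import Relation.Unary using (Decidable)
open import Relation.Binary.PropositionalEquality
open import Algebra.Properties.CommutativeSemigroup +-commutativeSemigroup
  using () renaming (interchange to +-interchange)
open import Algebra.Properties.CommutativeSemigroup *-commutativeSemigroup
  using () renaming (interchange to *-interchange; x∙yz≈y∙xz to x*[y*z]≡y*[x*z]; x∙yz≈yx∙z to x*[y*z]≡y*x*z)

-- Finite sums and counting

Bool→ℕ : Bool → ℕ
Bool→ℕ true  = 1
Bool→ℕ false = 0

∑ : {A : Set} → List A → (A → ℕ) → ℕ
∑ []       g = 0
∑ (x ∷ xs) g = g x + ∑ xs g

infix 5 ∑
syntax ∑ xs (λ x → e) = ∑[ x ∈ xs ] e

count : {A : Set} → (A → Bool) → List A → ℕ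
count p xs = ∑[ x ∈ xs ] Bool→ℕ (p x)

module _ {A : Set} where

  ∑-cong : ∀ {f g : A → ℕ} xs → (∀ x → f x ≡ g x) → ∑ xs f ≡ ∑ xs g
  ∑-cong []       f≗g = refl
  ∑-cong (x ∷ xs) f≗g = cong₂ _+_ (f≗g x) (∑-cong xs f≗g)

  ∑-mono : ∀ {f g : A → ℕ} xs → (∀ x → f x ≤ g x) → ∑ xs f ≤ ∑ xs g
  ∑-mono []       f≤g = z≤n
  ∑-mono (x ∷ xs) f≤g = +-mono-≤ (f≤g x) (∑-mono xs f≤g)

  ∑-++ : ∀ (f : A → ℕ) xs ys → ∑ (xs ++ ys) f ≡ ∑ xs f + ∑ ys f
  ∑-++ f []       ys = refl
  ∑-++ f (x ∷ xs) ys = trans (cong (f x +_) (∑-++ f xs ys)) (sym (+-assoc (f x) _ _))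

  ∑-+ : ∀ (f g : A → ℕ) xs → ∑[ x ∈ xs ] (f x + g x) ≡ ∑ xs f + ∑ xs g
  ∑-+ f g []       = refl
  ∑-+ f g (x ∷ xs) = trans (cong (f x + g x +_) (∑-+ f g xs)) (+-interchange (f x) (g x) _ _)

  ∑-*ˡ : ∀ c (f : A → ℕ) xs → ∑[ x ∈ xs ] (c * f x) ≡ c * ∑ xs f
  ∑-*ˡ c f []       = sym (*-zeroʳ c)
  ∑-*ˡ c f (x ∷ xs) = trans (cong (c * f x +_) (∑-*ˡ c f xs)) (sym (*-distribˡ-+ c (f x) _))

  ∑-*ʳ : ∀ c (f : A → ℕ) xs → ∑[ x ∈ xs ] (f x * c) ≡ ∑ xs f * c
  ∑-*ʳ c f xs = trans (∑-cong xs (λ x → *-comm (f x) c)) (trans (∑-*ˡ c f xs) (*-comm c _))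

  ∑-const : ∀ c (xs : List A) → ∑[ _ ∈ xs ] c ≡ c * length xs
  ∑-const c []       = sym (*-zeroʳ c)
  ∑-const c (x ∷ xs) = trans (cong (c +_) (∑-const c xs)) (sym (*-suc c (length xs)))

  ∑-zero : ∀ (xs : List A) → ∑[ _ ∈ xs ] 0 ≡ 0
  ∑-zero xs = ∑-const 0 xs

  count≤length : ∀ (p : A → Bool) xs → count p xs ≤ length xs
  count≤length p []       = z≤n
  count≤length p (x ∷ xs) with p x
  ... | true  = s≤s (count≤length p xs)
  ... | false = m≤n⇒m≤1+n (count≤length p xs)

  count-∧ : ∀ b (q : A → Bool) xs → count (λ x → b ∧ q x) xs ≡ Bool→ℕ b * count q xs
  count-∧ true  q xs = sym (+-identityʳ _)
  count-∧ false q xs = ∑-zero xs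

  count-not : ∀ (p : A → Bool) xs → count (not ∘ p) xs + count p xs ≡ length xs
  count-not p []       = refl
  count-not p (x ∷ xs) with p x
  ... | true  = trans (+-suc _ _) (cong suc (count-not p xs))
  ... | false = cong suc (count-not p xs)

  length-filter : ∀ {P : A → Set} (P? : Decidable P) xs → length (filter P? xs) ≡ count (λ x → does (P? x)) xs
  length-filter P? []       = refl
  length-filter P? (x ∷ xs) with does (P? x)
  ... | true  = cong suc (length-filter P? xs)
  ... | false = length-filter P? xs

module _ {A B : Set} where

  ∑-map : ∀ (g : B → ℕ) (f : A → B) xs → ∑ (map f xs) g ≡ ∑[ x ∈ xs ] g (f x)
  ∑-map g f []       = refl
  ∑-map g f (x ∷ xs) = cong (g (f x) +_) (∑-map g f xs)

  ∑-concatMap : ∀ (g : B → ℕ) (f : A → List B) xs → ∑ (concatMap f xs) g ≡ ∑[ x ∈ xs ] ∑ (f x) g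
  ∑-concatMap g f []       = refl
  ∑-concatMap g f (x ∷ xs) = trans (∑-++ g (f x) (concatMap f xs)) (cong (∑ (f x) g +_) (∑-concatMap g f xs))

  ∑-swap : ∀ (f : A → B → ℕ) xs ys → ∑[ a ∈ xs ] ∑[ b ∈ ys ] f a b ≡ ∑[ b ∈ ys ] ∑[ a ∈ xs ] f a b
  ∑-swap f []       ys = sym (∑-zero ys)
  ∑-swap f (x ∷ xs) ys = trans (cong (∑ ys (f x) +_) (∑-swap f xs ys)) (sym (∑-+ (f x) _ ys))

  ∑*∑ : ∀ (f : A → ℕ) (g : B → ℕ) xs ys → ∑ xs f * ∑ ys g ≡ ∑[ a ∈ xs ] ∑[ b ∈ ys ] f a * g b
  ∑*∑ f g xs ys = trans (sym (∑-*ʳ (∑ ys g) f xs)) (∑-cong xs (λ a → sym (∑-*ˡ (f a) g ys)))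

  length-concatMap : ∀ (f : A → List B) xs → length (concatMap f xs) ≡ ∑[ x ∈ xs ] length (f x)
  length-concatMap f []       = refl
  length-concatMap f (x ∷ xs) = trans (length-++ (f x)) (cong (length (f x) +_) (length-concatMap f xs))

Bool→ℕ-∨ : ∀ a b → Bool→ℕ (a ∨ b) ≤ Bool→ℕ a + Bool→ℕ b
Bool→ℕ-∨ true  b = s≤s z≤n
Bool→ℕ-∨ false b = ≤-refl

Bool→ℕ-∨-disjoint : ∀ a b → (a ≡ true → b ≡ true → ⊥) → Bool→ℕ (a ∨ b) ≡ Bool→ℕ a + Bool→ℕ b
Bool→ℕ-∨-disjoint true  true  disj = ⊥-elim (disj refl refl)
Bool→ℕ-∨-disjoint true  false disj = refl
Bool→ℕ-∨-disjoint false b     disj = refl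

count-none : ∀ {A : Set} (p : A → Bool) {xs} → All (λ x → p x ≡ false) xs → count p xs ≡ 0
count-none p []           = refl
count-none p (px ∷ pxs) rewrite px = count-none p pxs

Bool→ℕ-split : ∀ b x → x ≡ Bool→ℕ b * x + Bool→ℕ (not b) * x
Bool→ℕ-split true  x = sym (trans (+-identityʳ _) (+-identityʳ x))
Bool→ℕ-split false x = sym (+-identityʳ x)

∑-filterᵇ : ∀ {A : Set} (p : A → Bool) (g : A → ℕ) xs → ∑ (filterᵇ p xs) g ≡ ∑[ x ∈ xs ] Bool→ℕ (p x) * g x
∑-filterᵇ p g []       = refl
∑-filterᵇ p g (x ∷ xs) with p x
... | true  = cong₂ _+_ (sym (+-identityʳ (g x))) (∑-filterᵇ p g xs)
... | false = ∑-filterᵇ p g xs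

-- Elementary inequalities

-- (y − x)(yᵐ − xᵐ) ≥ 0, with both sides moved so that no subtraction occurs.
rearrangement-≤ : ∀ m {x y} → x ≤ y → x * y ^ m + y * x ^ m ≤ x * x ^ m + y * y ^ m
rearrangement-≤ m {x} x≤y with m≤n⇒∃[o]m+o≡n x≤y
... | d , refl = subst₂ _≤_ (sym (lhs x d (x ^ m) ((x + d) ^ m))) (sym (rhs x d (x ^ m) ((x + d) ^ m)))
  (+-monoʳ-≤ (x * x ^ m + x * (x + d) ^ m) (*-monoʳ-≤ d (^-monoˡ-≤ m (m≤m+n x d))))
  where
  lhs : ∀ x d X Y → x * Y + (x + d) * X ≡ x * X + x * Y + d * X
  lhs = solve-∀
  rhs : ∀ x d X Y → x * X + (x + d) * Y ≡ x * X + x * Y + d * Y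
  rhs = solve-∀

rearrangement : ∀ m x y → x * y ^ m + y * x ^ m ≤ x * x ^ m + y * y ^ m
rearrangement m x y with ≤-total x y
... | inj₁ x≤y = rearrangement-≤ m x≤y
... | inj₂ y≤x = subst₂ _≤_ (+-comm (y * x ^ m) _) (+-comm (y * y ^ m) _) (rearrangement-≤ m y≤x)

chebyshev : ∀ {A : Set} (d : A → ℕ) m (xs : List A) →
  ∑ xs d * (∑[ x ∈ xs ] d x ^ m) ≤ length xs * (∑[ x ∈ xs ] d x ^ suc m)
chebyshev d m xs = *-cancelˡ-≤ 2 (subst₂ _≤_ (sym double-lhs) double-rhs
  (∑-mono xs λ a → ∑-mono xs λ b → rearrangement m (d a) (d b)))
  where
  open ≡-Reasoning
  L = ∑ xs d * (∑[ x ∈ xs ] d x ^ m)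
  S = ∑[ x ∈ xs ] d x ^ suc m
  twice : ∀ a → 2 * a ≡ a + a
  twice = solve-∀
  double-lhs : 2 * L ≡ ∑[ a ∈ xs ] ∑[ b ∈ xs ] (d a * d b ^ m + d b * d a ^ m)
  double-lhs = begin
    2 * L ≡⟨ twice L ⟩
    L + L ≡⟨ cong₂ _+_ (∑*∑ d (λ x → d x ^ m) xs xs)
                       (trans (∑*∑ d (λ x → d x ^ m) xs xs) (∑-swap (λ a b → d a * d b ^ m) xs xs)) ⟩
    (∑[ a ∈ xs ] ∑[ b ∈ xs ] d a * d b ^ m) + (∑[ a ∈ xs ] ∑[ b ∈ xs ] d b * d a ^ m)
      ≡⟨ sym (∑-+ _ _ xs) ⟩
    ∑[ a ∈ xs ] ((∑[ b ∈ xs ] d a * d b ^ m) + (∑[ b ∈ xs ] d b * d a ^ m))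
      ≡⟨ ∑-cong xs (λ a → sym (∑-+ _ _ xs)) ⟩
    ∑[ a ∈ xs ] ∑[ b ∈ xs ] (d a * d b ^ m + d b * d a ^ m) ∎
  double-rhs : ∑[ a ∈ xs ] ∑[ b ∈ xs ] (d a ^ suc m + d b ^ suc m) ≡ 2 * (length xs * S)
  double-rhs = begin
    ∑[ a ∈ xs ] ∑[ b ∈ xs ] (d a ^ suc m + d b ^ suc m)
      ≡⟨ ∑-cong xs (λ a → trans (∑-+ _ _ xs) (cong (_+ S) (∑-const (d a ^ suc m) xs))) ⟩
    ∑[ a ∈ xs ] (d a ^ suc m * length xs + S)
      ≡⟨ trans (∑-+ _ _ xs) (cong₂ _+_ (∑-*ʳ (length xs) (λ a → d a ^ suc m) xs) (∑-const S xs)) ⟩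
    S * length xs + S * length xs
      ≡⟨ trans (sym (twice (S * length xs))) (cong (2 *_) (*-comm S (length xs))) ⟩
    2 * (length xs * S) ∎

power-mean : ∀ {A : Set} (d : A → ℕ) t (xs : List A) →
  ∑ xs d ^ suc t ≤ length xs ^ t * (∑[ x ∈ xs ] d x ^ suc t)
power-mean d zero xs = subst₂ _≤_ (sym (*-identityʳ _))
  (trans (∑-cong xs (λ x → sym (*-identityʳ (d x)))) (sym (+-identityʳ _))) ≤-refl
power-mean d (suc t) xs = begin
  D * D ^ suc t         ≤⟨ *-monoʳ-≤ D (power-mean d t xs) ⟩
  D * (L ^ t * S₁)      ≡⟨ x*[y*z]≡y*[x*z] D (L ^ t) S₁ ⟩
  L ^ t * (D * S₁)      ≤⟨ *-monoʳ-≤ (L ^ t) (chebyshev d (suc t) xs) ⟩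
  L ^ t * (L * S₂)      ≡⟨ x*[y*z]≡y*x*z (L ^ t) L S₂ ⟩
  L * L ^ t * S₂        ∎
  where
  open ≤-Reasoning
  D = ∑ xs d
  L = length xs
  S₁ = ∑[ x ∈ xs ] d x ^ suc t
  S₂ = ∑[ x ∈ xs ] d x ^ suc (suc t)

pigeonhole : ∀ {A : Set} (g : A → ℕ) β (xs : List A) → 0 < ∑ xs g → β * length xs ≤ ∑ xs g →
  ∃ λ x → x ∈ xs × β ≤ g x
pigeonhole g β (x ∷ xs) ∑>0 avg≤∑ with β ≤? g x
... | yes β≤gx = x , here refl , β≤gx
... | no  β≰gx =
  let y , y∈xs , β≤gy = pigeonhole g β xs (≤-<-trans z≤n avg<∑) (<⇒≤ avg<∑) in y , there y∈xs , β≤gy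
  where
  avg<∑ : β * length xs < ∑ xs g
  avg<∑ = +-cancelˡ-< β _ _ (begin-strict
    β + β * length xs   ≡⟨ sym (*-suc β (length xs)) ⟩
    β * suc (length xs) ≤⟨ avg≤∑ ⟩
    g x + ∑ xs g        <⟨ +-monoˡ-< (∑ xs g) (≰⇒> β≰gx) ⟩
    β + ∑ xs g          ∎)
    where open ≤-Reasoning

^-distribʳ-* : ∀ m x y → (x * y) ^ m ≡ x ^ m * y ^ m
^-distribʳ-* zero    x y = refl
^-distribʳ-* (suc m) x y = trans (cong (x * y *_) (^-distribʳ-* m x y)) (*-interchange x y (x ^ m) (y ^ m))

-- Boolean tests on finite sets and tuples

_≡ᵇ_ : ∀ {n} → Fin n → Fin n → Bool
a ≡ᵇ b = does (a ≟ b)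

module _ {n} {a b : Fin n} where

  ≡ᵇ⇒≡ : a ≡ᵇ b ≡ true → a ≡ b
  ≡ᵇ⇒≡ eq with a ≟ b
  ... | yes a≡b = a≡b

  ≡⇒≡ᵇ : a ≡ b → a ≡ᵇ b ≡ true
  ≡⇒≡ᵇ = dec-true (a ≟ b)

  ≢⇒≡ᵇ-false : a ≢ b → a ≡ᵇ b ≡ false
  ≢⇒≡ᵇ-false = dec-false (a ≟ b)

  ≡ᵇ-false⇒≢ : a ≡ᵇ b ≡ false → a ≢ b
  ≡ᵇ-false⇒≢ eq with a ≟ b
  ... | no a≢b = a≢b

allᶠ : ∀ {m} → (Fin m → Bool) → Bool
allᶠ {zero}  q = true
allᶠ {suc m} q = q zero ∧ allᶠ (q ∘ suc)

anyᶠ : ∀ {m} → (Fin m → Bool) → Bool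
anyᶠ {zero}  q = false
anyᶠ {suc m} q = q zero ∨ anyᶠ (q ∘ suc)

allᶠ⇒ : ∀ {m} (q : Fin m → Bool) → allᶠ q ≡ true → ∀ j → q j ≡ true
allᶠ⇒ q all-q zero    = ∧-conicalˡ (q zero) _ all-q
allᶠ⇒ q all-q (suc j) = allᶠ⇒ (q ∘ suc) (∧-conicalʳ (q zero) _ all-q) j

anyᶠ⇒ : ∀ {m} (q : Fin m → Bool) → anyᶠ q ≡ true → ∃ λ j → q j ≡ true
anyᶠ⇒ {suc m} q any-q with q zero in eq
... | true  = zero , eq
... | false = let j , qj = anyᶠ⇒ (q ∘ suc) any-q in suc j , qj

⇒anyᶠ : ∀ {m} (q : Fin m → Bool) j → q j ≡ true → anyᶠ q ≡ true
⇒anyᶠ q zero    qj rewrite qj = refl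
⇒anyᶠ q (suc j) qj with q zero
... | true  = refl
... | false = ⇒anyᶠ (q ∘ suc) j qj

¬anyᶠ⇒ : ∀ {m} (q : Fin m → Bool) → anyᶠ q ≡ false → ∀ j → q j ≡ false
¬anyᶠ⇒ q none j with q j in qj
... | false = refl
... | true  = trans (sym (⇒anyᶠ q j qj)) none

injectiveᵇ : ∀ {m n} → (Fin m → Fin n) → Bool
injectiveᵇ {zero}  w = true
injectiveᵇ {suc m} w = not (anyᶠ (λ j → w zero ≡ᵇ w (suc j))) ∧ injectiveᵇ (w ∘ suc)

injectiveᵇ⇒injective : ∀ {m n} (w : Fin m → Fin n) → injectiveᵇ w ≡ true → Injective _≡_ _≡_ w
injectiveᵇ⇒injective {suc m} w inj-w {i} {j} = go i j
  where
  inj-tail : injectiveᵇ (w ∘ suc) ≡ true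
  inj-tail = ∧-conicalʳ (not (anyᶠ (λ j → w zero ≡ᵇ w (suc j)))) _ inj-w
  head-fresh : ∀ j → w zero ≢ w (suc j)
  head-fresh = ≡ᵇ-false⇒≢ ∘ ¬anyᶠ⇒ _ (not-injective (∧-conicalˡ _ _ inj-w))
  go : ∀ i j → w i ≡ w j → i ≡ j
  go zero    zero    _  = refl
  go zero    (suc j) eq = contradiction eq (head-fresh j)
  go (suc i) zero    eq = contradiction (sym eq) (head-fresh i)
  go (suc i) (suc j) eq = cong suc (injectiveᵇ⇒injective (w ∘ suc) inj-tail eq)

module _ {n : ℕ} where

  count-≡ᵇ-fresh : ∀ {x} {xs : List (Fin n)} → All (x ≢_) xs → count (_≡ᵇ x) xs ≡ 0
  count-≡ᵇ-fresh x∉xs = count-none _ (All.map (λ x≢a → ≢⇒≡ᵇ-false (x≢a ∘ sym)) x∉xs)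

  count-≡ᵇ-unique : ∀ {xs : List (Fin n)} → Unique xs → ∀ c → count (_≡ᵇ c) xs ≤ 1
  count-≡ᵇ-unique []                      c = z≤n
  count-≡ᵇ-unique {x ∷ xs} (x∉xs ∷ uniq) c with x ≟ c
  ... | yes refl = ≤-reflexive (cong suc (count-≡ᵇ-fresh x∉xs))
  ... | no  _    = count-≡ᵇ-unique uniq c

  count-≡ᵇ-unique-∈ : ∀ {xs : List (Fin n)} → Unique xs → ∀ {c} → c ∈ xs → count (_≡ᵇ c) xs ≡ 1
  count-≡ᵇ-unique-∈ {x ∷ xs} (x∉xs ∷ uniq) {c} c∈ with x ≟ c | c∈
  ... | yes refl | _          = cong suc (count-≡ᵇ-fresh x∉xs)
  ... | no  x≢c  | here c≡x   = contradiction (sym c≡x) x≢c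
  ... | no  _    | there c∈xs = count-≡ᵇ-unique-∈ uniq c∈xs

  count-≡ᵇ-allFin : ∀ c → count (_≡ᵇ c) (allFin n) ≡ 1
  count-≡ᵇ-allFin c = count-≡ᵇ-unique-∈ (allFin⁺ n) (∈-allFin c)

  count-image : ∀ {M} (G : Fin M → Fin n) → Injective _≡_ _≡_ G →
    count (λ v → anyᶠ (λ x → v ≡ᵇ G x)) (allFin n) ≡ M
  count-image {zero}  G G-inj = ∑-zero (allFin n)
  count-image {suc M} G G-inj = begin
    count (λ v → (v ≡ᵇ G zero) ∨ anyᶠ (λ x → v ≡ᵇ G (suc x))) (allFin n)
      ≡⟨ ∑-cong (allFin n) (λ v → Bool→ℕ-∨-disjoint _ _ (head∉tail v)) ⟩
    ∑[ v ∈ allFin n ] (Bool→ℕ (v ≡ᵇ G zero) + Bool→ℕ (anyᶠ (λ x → v ≡ᵇ G (suc x))))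
      ≡⟨ ∑-+ _ _ (allFin n) ⟩
    count (_≡ᵇ G zero) (allFin n) + count (λ v → anyᶠ (λ x → v ≡ᵇ G (suc x))) (allFin n)
      ≡⟨ cong₂ _+_ (count-≡ᵇ-allFin (G zero)) (count-image (G ∘ suc) (Finₚ.suc-injective ∘ G-inj)) ⟩
    suc M ∎
    where
    open ≡-Reasoning
    head∉tail : ∀ v → v ≡ᵇ G zero ≡ true → anyᶠ (λ x → v ≡ᵇ G (suc x)) ≡ true → ⊥
    head∉tail v v≡G0 v∈G′ with anyᶠ⇒ (λ x → v ≡ᵇ G (suc x)) v∈G′
    ... | j , v≡Gj = Finₚ.0≢1+n (G-inj (trans (sym (≡ᵇ⇒≡ {a = v} v≡G0)) (≡ᵇ⇒≡ {a = v} v≡Gj)))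

tuplesIn : ∀ {k n} → (Fin k → List (Fin n)) → List (Fin k → Fin n)
tuplesIn {zero}  {n} X = allTuples zero n
tuplesIn {suc k}     X = concatMap (λ a → map (a ◂_) (tuplesIn (X ∘ suc))) (X zero)

length-tuplesIn : ∀ {k n s} (X : Fin k → List (Fin n)) → (∀ i → length (X i) ≤ s) →
  length (tuplesIn X) ≤ s ^ k
length-tuplesIn {zero}          X ∣X∣≤s = ≤-refl
length-tuplesIn {suc k} {s = s} X ∣X∣≤s = begin
  length (tuplesIn X)                     ≡⟨ length-concatMap _ (X zero) ⟩
  ∑[ a ∈ X zero ] length (map (a ◂_) Y)   ≡⟨ ∑-cong (X zero) (λ a → length-map (a ◂_) Y) ⟩
  ∑[ a ∈ X zero ] length Y                ≡⟨ ∑-const _ (X zero) ⟩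
  length Y * length (X zero)              ≤⟨ *-mono-≤ (length-tuplesIn (X ∘ suc) (∣X∣≤s ∘ suc)) (∣X∣≤s zero) ⟩
  s ^ k * s                               ≡⟨ *-comm (s ^ k) s ⟩
  s ^ suc k                               ∎
  where
  open ≤-Reasoning
  Y = tuplesIn (X ∘ suc)

∈-tuplesIn⁻ : ∀ {k n} (X : Fin k → List (Fin n)) {y} → y ∈ tuplesIn X → ∀ i → y i ∈ X i
∈-tuplesIn⁻ {suc k} X y∈ i with find (∈-concatMap⁻ (λ a → map (a ◂_) (tuplesIn (X ∘ suc))) {xs = X zero} y∈)
... | a , a∈X₀ , y∈aY with ∈-map⁻ (a ◂_) y∈aY
... | z , z∈Y , refl with i
... | zero  = a∈X₀
... | suc i = ∈-tuplesIn⁻ (X ∘ suc) z∈Y i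

count-◂ : ∀ {k n} (G : (Fin (suc k) → Fin n) → Bool) (X₀ : List (Fin n)) (Y : List (Fin k → Fin n)) →
  count G (concatMap (λ a → map (a ◂_) Y) X₀) ≡ ∑[ a ∈ X₀ ] count (λ y → G (a ◂ y)) Y
count-◂ G X₀ Y = trans (∑-concatMap _ _ X₀) (∑-cong X₀ (λ a → ∑-map (λ x → Bool→ℕ (G x)) (a ◂_) Y))

count-tuplesIn : ∀ {k n} (G : (Fin (suc k) → Fin n) → Bool) (X : Fin (suc k) → List (Fin n)) →
  count G (tuplesIn X) ≡ ∑[ a ∈ X zero ] count (λ y → G (a ◂ y)) (tuplesIn (X ∘ suc))
count-tuplesIn G X = count-◂ G (X zero) (tuplesIn (X ∘ suc))

count-allᶠ-tuplesIn : ∀ {n} m (P : Fin n → Bool) (X₀ : List (Fin n)) →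
  count (λ w → allᶠ (P ∘ w)) (tuplesIn {m} (λ _ → X₀)) ≡ count P X₀ ^ m
count-allᶠ-tuplesIn zero    P X₀ = refl
count-allᶠ-tuplesIn (suc m) P X₀ = begin
  count (λ w → allᶠ (P ∘ w)) (tuplesIn {suc m} (λ _ → X₀))
    ≡⟨ count-tuplesIn _ (λ _ → X₀) ⟩
  ∑[ a ∈ X₀ ] count (λ y → P a ∧ allᶠ (P ∘ y)) Y
    ≡⟨ ∑-cong X₀ (λ a → count-∧ (P a) _ Y) ⟩
  ∑[ a ∈ X₀ ] Bool→ℕ (P a) * count (λ y → allᶠ (P ∘ y)) Y
    ≡⟨ ∑-*ʳ _ (Bool→ℕ ∘ P) X₀ ⟩
  count P X₀ * count (λ y → allᶠ (P ∘ y)) Y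
    ≡⟨ cong (count P X₀ *_) (count-allᶠ-tuplesIn m P X₀) ⟩
  count P X₀ ^ suc m ∎
  where
  open ≡-Reasoning
  Y = tuplesIn {m} (λ _ → X₀)

-- H is a function on tuples and there is no function extensionality, so a tuple is
-- rebuilt with _◂_, exactly as allTuples builds it, before an edge predicate is applied.
canonical : ∀ {k n} → (Fin k → Fin n) → Fin k → Fin n
canonical {zero}  {n} _ = nullary (allTuples zero n)
  where
  nullary : List (Fin zero → Fin n) → Fin zero → Fin n
  nullary (x ∷ _) = x
  nullary []      ()
canonical {suc k}     x = x zero ◂ canonical (x ∘ suc)

canonical-≗ : ∀ {k n} (x : Fin k → Fin n) i → canonical x i ≡ x i
canonical-≗ x zero    = refl
canonical-≗ x (suc i) = canonical-≗ (x ∘ suc) i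

count-∈-image : ∀ {n} m (w : Fin m → Fin n) {X₀ : List (Fin n)} → Unique X₀ →
  count (λ a → anyᶠ (λ j → a ≡ᵇ w j)) X₀ ≤ m
count-∈-image zero    w {X₀} _    = ≤-reflexive (∑-zero X₀)
count-∈-image (suc m) w {X₀} uniq = begin
  count (λ a → (a ≡ᵇ w zero) ∨ anyᶠ (λ j → a ≡ᵇ w (suc j))) X₀
    ≤⟨ ∑-mono X₀ (λ a → Bool→ℕ-∨ (a ≡ᵇ w zero) _) ⟩
  ∑[ a ∈ X₀ ] (Bool→ℕ (a ≡ᵇ w zero) + Bool→ℕ (anyᶠ (λ j → a ≡ᵇ w (suc j))))
    ≡⟨ ∑-+ _ _ X₀ ⟩
  count (_≡ᵇ w zero) X₀ + count (λ a → anyᶠ (λ j → a ≡ᵇ w (suc j))) X₀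
    ≤⟨ +-mono-≤ (count-≡ᵇ-unique uniq (w zero)) (count-∈-image m (w ∘ suc) uniq) ⟩
  suc m ∎
  where open ≤-Reasoning

nonInjective-◂ : ∀ {m n} (a : Fin n) (w : Fin m → Fin n) →
  Bool→ℕ (not (injectiveᵇ (a ◂ w))) ≤ Bool→ℕ (anyᶠ (λ j → a ≡ᵇ w j)) + Bool→ℕ (not (injectiveᵇ w))
nonInjective-◂ a w with anyᶠ (λ j → a ≡ᵇ w j)
... | true  = s≤s z≤n
... | false = ≤-refl

module _ {n} {X₀ : List (Fin n)} {s} (uniq : Unique X₀) (∣X₀∣≤s : length X₀ ≤ s) where

  count-nonInjective-◂ : ∀ m →
    count (not ∘ injectiveᵇ) (tuplesIn {suc m} (λ _ → X₀)) ≤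
    m * s ^ m + s * count (not ∘ injectiveᵇ) (tuplesIn {m} (λ _ → X₀))
  count-nonInjective-◂ m = begin
    count (not ∘ injectiveᵇ) (tuplesIn {suc m} (λ _ → X₀))
      ≡⟨ count-tuplesIn _ (λ _ → X₀) ⟩
    ∑[ a ∈ X₀ ] count (λ y → not (injectiveᵇ (a ◂ y))) V
      ≤⟨ ∑-mono X₀ (λ a → ∑-mono V (nonInjective-◂ a)) ⟩
    ∑[ a ∈ X₀ ] ∑[ y ∈ V ] (Bool→ℕ (anyᶠ (λ j → a ≡ᵇ y j)) + Bool→ℕ (not (injectiveᵇ y)))
      ≡⟨ trans (∑-cong X₀ (λ a → ∑-+ _ _ V)) (∑-+ _ _ X₀) ⟩
    (∑[ a ∈ X₀ ] count (λ y → anyᶠ (λ j → a ≡ᵇ y j)) V) + (∑[ _ ∈ X₀ ] NI)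
      ≡⟨ cong₂ _+_ (∑-swap (λ a y → Bool→ℕ (anyᶠ (λ j → a ≡ᵇ y j))) X₀ V) (∑-const NI X₀) ⟩
    (∑[ y ∈ V ] count (λ a → anyᶠ (λ j → a ≡ᵇ y j)) X₀) + NI * length X₀
      ≤⟨ +-mono-≤ (∑-mono V (λ y → count-∈-image m y uniq)) (*-monoʳ-≤ NI ∣X₀∣≤s) ⟩
    (∑[ _ ∈ V ] m) + NI * s
      ≡⟨ cong₂ _+_ (∑-const m V) (*-comm NI s) ⟩
    m * length V + s * NI
      ≤⟨ +-monoˡ-≤ (s * NI) (*-monoʳ-≤ m (length-tuplesIn {m} (λ _ → X₀) (λ _ → ∣X₀∣≤s))) ⟩
    m * s ^ m + s * NI ∎
    where
    open ≤-Reasoning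
    V = tuplesIn {m} (λ _ → X₀)
    NI = count (not ∘ injectiveᵇ) V

  count-nonInjective : ∀ m → s * count (not ∘ injectiveᵇ) (tuplesIn {m} (λ _ → X₀)) ≤ m * m * s ^ m
  count-nonInjective zero    = ≤-reflexive (*-zeroʳ s)
  count-nonInjective (suc m) = begin
    s * NI′                          ≤⟨ *-monoʳ-≤ s (count-nonInjective-◂ m) ⟩
    s * (m * s ^ m + s * NI)         ≡⟨ expand s m (s ^ m) NI ⟩
    m * s ^ suc m + s * (s * NI)     ≤⟨ +-monoʳ-≤ (m * s ^ suc m) (*-monoʳ-≤ s (count-nonInjective m)) ⟩
    m * s ^ suc m + s * (m * m * s ^ m) ≡⟨ collect s m (s ^ m) ⟩
    (m + m * m) * s ^ suc m          ≤⟨ *-monoˡ-≤ (s ^ suc m) (m+m*m≤[1+m]*[1+m] m) ⟩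
    suc m * suc m * s ^ suc m        ∎
    where
    open ≤-Reasoning
    NI = count (not ∘ injectiveᵇ) (tuplesIn {m} (λ _ → X₀))
    NI′ = count (not ∘ injectiveᵇ) (tuplesIn {suc m} (λ _ → X₀))
    expand : ∀ s m P N → s * (m * P + s * N) ≡ m * (s * P) + s * (s * N)
    expand = solve-∀
    collect : ∀ s m P → m * (s * P) + s * (m * m * P) ≡ (m + m * m) * (s * P)
    collect = solve-∀
    m+m*m≤[1+m]*[1+m] : ∀ m → m + m * m ≤ suc m * suc m
    m+m*m≤[1+m]*[1+m] m = ≤-trans (m≤n+m (m + m * m) (suc m)) (≤-reflexive (square m))
      where square : ∀ m → suc m + (m + m * m) ≡ suc m * suc m
            square = solve-∀

-- Complete k-partite subgraphs

record CompletePartite {k n} (t : ℕ) (X : Fin k → List (Fin n)) (G : (Fin k → Fin n) → Bool) : Set where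
  field
    part           : Fin k → Fin (suc t) → Fin n
    part-∈         : ∀ i a → part i a ∈ X i
    part-injective : ∀ i → Injective _≡_ _≡_ (part i)
    complete       : ∀ (h : Fin k → Fin (suc t)) → G (canonical (λ i → part i (h i))) ≡ true

-- In the induction on k the link of a heavy (t+1)-tuple has density constant 2 c^(t+1), and
-- s ≥ 2 c^(t+1) (t+1)² makes the (t+1)-tuples with a repeated vertex negligible.
kstBound : ℕ → ℕ → ℕ → ℕ
kstBound t zero    c = 0
kstBound t (suc k) c = 2 * c ^ suc t * (suc t * suc t) + kstBound t k (2 * c ^ suc t) + 1

module HeavyTuple {n} t k (c s : ℕ) (X : Fin (suc k) → List (Fin n)) (G : (Fin (suc k) → Fin n) → Bool)
  (X₀-unique : Unique (X zero)) (∣X∣≤s : ∀ i → length (X i) ≤ s)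
  (dense : s ^ suc k ≤ c * count G (tuplesIn X))
  (s-large : 2 * c ^ suc t * (suc t * suc t) + 1 ≤ s) where

  t′ = suc t
  C = c ^ t′
  V = tuplesIn {t′} (λ _ → X zero)
  M = tuplesIn (X ∘ suc)

  link : (Fin t′ → Fin n) → (Fin k → Fin n) → Bool
  link w y = allᶠ (λ j → G (w j ◂ y))

  degree : (Fin t′ → Fin n) → ℕ
  degree w = count (link w) M

  instance
    s-nonZero : NonZero s
    s-nonZero = >-nonZero (≤-trans (m≤n+m 1 _) s-large)

  -- Jensen's inequality for x ↦ x^(t+1) applied to the degrees d y of the (k−1)-tuples y; double
  -- counting turns ∑ d y^(t+1) into the total link size of the (t+1)-tuples of the first part.
  degree-sum : s ^ (k + t′) ≤ C * ∑ V degree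
  degree-sum = *-cancelˡ-≤ (s ^ (k * t)) (begin
    s ^ (k * t) * s ^ (k + t′)      ≡⟨ sym (^-distribˡ-+-* s (k * t) (k + t′)) ⟩
    s ^ (k * t + (k + t′))          ≡⟨ cong (s ^_) (exponent k t) ⟩
    s ^ (suc k * t′)                ≡⟨ sym (^-*-assoc s (suc k) t′) ⟩
    (s ^ suc k) ^ t′                ≤⟨ ^-monoˡ-≤ t′ dense ⟩
    (c * N) ^ t′                    ≡⟨ ^-distribʳ-* t′ c N ⟩
    C * N ^ t′                      ≡⟨ cong (λ z → C * z ^ t′) N≡∑d ⟩
    C * ∑ M d ^ t′                  ≤⟨ *-monoʳ-≤ C (power-mean d t M) ⟩
    C * (length M ^ t * (∑[ y ∈ M ] d y ^ t′))
      ≤⟨ *-monoʳ-≤ C (*-monoˡ-≤ _ (^-monoˡ-≤ t (length-tuplesIn (X ∘ suc) (∣X∣≤s ∘ suc)))) ⟩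
    C * ((s ^ k) ^ t * (∑[ y ∈ M ] d y ^ t′))
      ≡⟨ cong₂ (λ a b → C * (a * b)) (^-*-assoc s k t) (sym ∑degree≡∑dᵗ′) ⟩
    C * (s ^ (k * t) * ∑ V degree)  ≡⟨ x*[y*z]≡y*[x*z] C (s ^ (k * t)) _ ⟩
    s ^ (k * t) * (C * ∑ V degree)  ∎)
    where
    open ≤-Reasoning
    instance _ = m^n≢0 s (k * t)
    N = count G (tuplesIn X)
    d : (Fin k → Fin n) → ℕ
    d y = count (λ a → G (a ◂ y)) (X zero)
    N≡∑d : N ≡ ∑ M d
    N≡∑d = trans (count-tuplesIn G X) (∑-swap (λ a y → Bool→ℕ (G (a ◂ y))) (X zero) M)
    ∑degree≡∑dᵗ′ : ∑ V degree ≡ ∑[ y ∈ M ] d y ^ t′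
    ∑degree≡∑dᵗ′ = trans (∑-swap (λ w y → Bool→ℕ (link w y)) V M)
                         (∑-cong M (λ y → count-allᶠ-tuplesIn t′ (λ a → G (a ◂ y)) (X zero)))
    exponent : ∀ k t → k * t + (k + suc t) ≡ suc k * suc t
    exponent = solve-∀

  ∑-injective ∑-nonInjective : ℕ
  ∑-injective    = ∑[ w ∈ V ] Bool→ℕ (injectiveᵇ w) * degree w
  ∑-nonInjective = ∑[ w ∈ V ] Bool→ℕ (not (injectiveᵇ w)) * degree w

  nonInjective-negligible : 2 * C * ∑-nonInjective ≤ s ^ (k + t′)
  nonInjective-negligible = *-cancelˡ-≤ s (begin
    s * (2 * C * ∑-nonInjective)
      ≤⟨ *-monoʳ-≤ s (*-monoʳ-≤ (2 * C) ∑-nonInjective≤) ⟩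
    s * (2 * C * (NI * s ^ k))       ≡⟨ rearrange s (2 * C) NI (s ^ k) ⟩
    2 * C * s ^ k * (s * NI)         ≤⟨ *-monoʳ-≤ (2 * C * s ^ k) (count-nonInjective X₀-unique (∣X∣≤s zero) t′) ⟩
    2 * C * s ^ k * (t′ * t′ * s ^ t′) ≡⟨ regroup (2 * C) (s ^ k) (t′ * t′) (s ^ t′) ⟩
    2 * C * (t′ * t′) * (s ^ k * s ^ t′)
      ≤⟨ *-monoˡ-≤ _ (≤-trans (m≤m+n _ 1) s-large) ⟩
    s * (s ^ k * s ^ t′)             ≡⟨ cong (s *_) (sym (^-distribˡ-+-* s k t′)) ⟩
    s * s ^ (k + t′)                 ∎)
    where
    open ≤-Reasoning
    NI = count (not ∘ injectiveᵇ) V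
    ∑-nonInjective≤ : ∑-nonInjective ≤ NI * s ^ k
    ∑-nonInjective≤ = ≤-trans
      (∑-mono V (λ w → *-monoʳ-≤ (Bool→ℕ (not (injectiveᵇ w)))
        (≤-trans (count≤length (link w) M) (length-tuplesIn (X ∘ suc) (∣X∣≤s ∘ suc)))))
      (≤-reflexive (∑-*ʳ (s ^ k) (λ w → Bool→ℕ (not (injectiveᵇ w))) V))
    rearrange : ∀ s D N P → s * (D * (N * P)) ≡ D * P * (s * N)
    rearrange = solve-∀
    regroup : ∀ D P T Q → D * P * (T * Q) ≡ D * T * (P * Q)
    regroup = solve-∀

  injective-heavy : s ^ (k + t′) ≤ 2 * C * ∑-injective
  injective-heavy = +-cancelʳ-≤ _ _ _ (begin
    S + S                                        ≡⟨ +-same S ⟩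
    2 * S                                        ≤⟨ *-monoʳ-≤ 2 degree-sum ⟩
    2 * (C * ∑ V degree)                         ≡⟨ cong (λ z → 2 * (C * z)) split ⟩
    2 * (C * (∑-injective + ∑-nonInjective))     ≡⟨ distribute C ∑-injective ∑-nonInjective ⟩
    2 * C * ∑-injective + 2 * C * ∑-nonInjective ≤⟨ +-monoʳ-≤ _ nonInjective-negligible ⟩
    2 * C * ∑-injective + S                      ∎)
    where
    open ≤-Reasoning
    S = s ^ (k + t′)
    split : ∑ V degree ≡ ∑-injective + ∑-nonInjective
    split = trans (∑-cong V (λ w → Bool→ℕ-split (injectiveᵇ w) (degree w))) (∑-+ _ _ V)
    +-same : ∀ a → a + a ≡ 2 * a
    +-same = solve-∀
    distribute : ∀ C a b → 2 * (C * (a + b)) ≡ 2 * C * a + 2 * C * b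
    distribute = solve-∀

  weight : (Fin t′ → Fin n) → ℕ
  weight w = 2 * C * (Bool→ℕ (injectiveᵇ w) * degree w)

  heavy-tuple : ∃ λ w → w ∈ V × injectiveᵇ w ≡ true × s ^ k ≤ 2 * C * degree w
  heavy-tuple =
    let w , w∈V , sᵏ≤weight = pigeonhole weight (s ^ k) V (<-≤-trans (m^n>0 s (k + t′)) sᵏ⁺ᵗ′≤∑weight)
                                                           (≤-trans sᵏ*∣V∣≤sᵏ⁺ᵗ′ sᵏ⁺ᵗ′≤∑weight)
        inj-w , sᵏ≤degree = heavy⇒injective (injectiveᵇ w) (m^n>0 s k) sᵏ≤weight
    in w , w∈V , inj-w , sᵏ≤degree
    where
    sᵏ⁺ᵗ′≤∑weight : s ^ (k + t′) ≤ ∑ V weight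
    sᵏ⁺ᵗ′≤∑weight = ≤-trans injective-heavy (≤-reflexive (sym (∑-*ˡ (2 * C) _ V)))
    sᵏ*∣V∣≤sᵏ⁺ᵗ′ : s ^ k * length V ≤ s ^ (k + t′)
    sᵏ*∣V∣≤sᵏ⁺ᵗ′ = ≤-trans (*-monoʳ-≤ (s ^ k) (length-tuplesIn {t′} (λ _ → X zero) (λ _ → ∣X∣≤s zero)))
                           (≤-reflexive (sym (^-distribˡ-+-* s k t′)))
    heavy⇒injective : ∀ b {x y} → 0 < y → y ≤ 2 * C * (Bool→ℕ b * x) → b ≡ true × y ≤ 2 * C * x
    heavy⇒injective true  {x} {y} _ y≤ = refl , subst (y ≤_) (cong (2 * C *_) (+-identityʳ x)) y≤
    heavy⇒injective false         y>0 y≤ = contradiction (≤-trans y≤ (≤-reflexive (*-zeroʳ (2 * C)))) (<⇒≱ y>0)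

complete-partite-subgraph : ∀ t k {n} (c s : ℕ) (X : Fin k → List (Fin n)) (G : (Fin k → Fin n) → Bool) →
  (∀ i → Unique (X i)) → (∀ i → length (X i) ≤ s) →
  s ^ k ≤ c * count G (tuplesIn X) → kstBound t k c ≤ s → CompletePartite t X G
complete-partite-subgraph t zero {n} c s X G _ _ dense _ with G (canonical {zero} {n} (λ ())) in G∅
... | true  = record { part = λ () ; part-∈ = λ () ; part-injective = λ () ; complete = λ _ → G∅ }
... | false = contradiction (≤-trans dense (≤-reflexive (*-zeroʳ c))) (<⇒≱ (s≤s z≤n))
complete-partite-subgraph t (suc k) c s X G uniq ∣X∣≤s dense bound = record
  { part           = λ { zero → w ; (suc i) → part i }
  ; part-∈         = λ { zero a → ∈-tuplesIn⁻ (λ _ → X zero) w∈V a ; (suc i) → part-∈ i }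
  ; part-injective = λ { zero → injectiveᵇ⇒injective w inj-w ; (suc i) → part-injective i }
  ; complete       = λ h → allᶠ⇒ (λ j → G (w j ◂ canonical (λ i → part i (h (suc i)))))
                                  (complete (h ∘ suc)) (h zero)
  }
  where
  open HeavyTuple t k c s X G (uniq zero) ∣X∣≤s dense (≤-trans (+-monoˡ-≤ 1 (m≤m+n _ _)) bound)
  heavy = heavy-tuple
  w = proj₁ heavy
  w∈V = proj₁ (proj₂ heavy)
  inj-w = proj₁ (proj₂ (proj₂ heavy))
  link-complete : CompletePartite t (X ∘ suc) (link w)
  link-complete = complete-partite-subgraph t k (2 * C) s (X ∘ suc) (link w) (uniq ∘ suc) (∣X∣≤s ∘ suc)
    (proj₂ (proj₂ (proj₂ heavy))) (≤-trans (≤-trans (m≤n+m _ (2 * C * (t′ * t′))) (m≤m+n _ 1)) bound)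
  open CompletePartite link-complete

-- Tiling packings of complete blocks

module CyclicShift (k : ℕ) .{{_ : NonZero k}} where

  infixl 6 _⊕_ _⊖_

  _⊕_ _⊖_ : Fin k → Fin k → Fin k
  i ⊕ j = (toℕ i + toℕ j) mod k
  i ⊖ j = (toℕ i + (k ∸ toℕ j)) mod k

  private
    open ≡-Reasoning

    toℕ-mod : ∀ m → toℕ (m mod k) ≡ m % k
    toℕ-mod m = toℕ-fromℕ< (m%n<n m k)

    [m%k+n]%k≡[m+n]%k : ∀ m n → (m % k + n) % k ≡ (m + n) % k
    [m%k+n]%k≡[m+n]%k m n = sym (begin
      (m + n) % k                      ≡⟨ cong (λ x → (x + n) % k) (m≡m%n+[m/n]*n m k) ⟩
      (m % k + m / k * k + n) % k      ≡⟨ cong (_% k) (+-assoc (m % k) _ n) ⟩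
      (m % k + (m / k * k + n)) % k    ≡⟨ cong (λ x → (m % k + x) % k) (+-comm _ n) ⟩
      (m % k + (n + m / k * k)) % k    ≡⟨ cong (_% k) (sym (+-assoc (m % k) n _)) ⟩
      (m % k + n + m / k * k) % k      ≡⟨ [m+kn]%n≡m%n (m % k + n) (m / k) k ⟩
      (m % k + n) % k                  ∎)

    shift-back : ∀ i {m n} → m + n ≡ k → toℕ ((toℕ ((toℕ i + m) mod k) + n) mod k) ≡ toℕ i
    shift-back i {m} {n} m+n≡k = begin
      toℕ ((toℕ ((toℕ i + m) mod k) + n) mod k) ≡⟨ toℕ-mod _ ⟩
      (toℕ ((toℕ i + m) mod k) + n) % k         ≡⟨ cong (λ x → (x + n) % k) (toℕ-mod _) ⟩
      ((toℕ i + m) % k + n) % k                 ≡⟨ [m%k+n]%k≡[m+n]%k _ n ⟩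
      (toℕ i + m + n) % k                       ≡⟨ cong (_% k) (+-assoc (toℕ i) m n) ⟩
      (toℕ i + (m + n)) % k                     ≡⟨ cong (λ x → (toℕ i + x) % k) m+n≡k ⟩
      (toℕ i + k) % k                           ≡⟨ [m+n]%n≡m%n (toℕ i) k ⟩
      toℕ i % k                                 ≡⟨ m<n⇒m%n≡m (toℕ<n i) ⟩
      toℕ i                                     ∎

  ⊕-comm : ∀ i j → i ⊕ j ≡ j ⊕ i
  ⊕-comm i j = cong (_mod k) (+-comm (toℕ i) (toℕ j))

  ⊖-⊕ : ∀ i j → i ⊖ j ⊕ j ≡ i
  ⊖-⊕ i j = toℕ-injective (shift-back i (m∸n+n≡m (<⇒≤ (toℕ<n j))))

  ⊕-⊖ : ∀ i j → i ⊕ j ⊖ j ≡ i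
  ⊕-⊖ i j = toℕ-injective (shift-back i (m+[n∸m]≡n (<⇒≤ (toℕ<n j))))

  ⊕-cancelʳ : ∀ {i i′} j → i ⊕ j ≡ i′ ⊕ j → i ≡ i′
  ⊕-cancelʳ {i} {i′} j eq = trans (sym (⊕-⊖ i j)) (trans (cong (_⊖ j) eq) (⊕-⊖ i′ j))

  ⊕-cancelˡ : ∀ i {j j′} → i ⊕ j ≡ i ⊕ j′ → j ≡ j′
  ⊕-cancelˡ i {j} {j′} eq = ⊕-cancelʳ i (trans (⊕-comm j i) (trans eq (⊕-comm i j′)))

remQuot-injective : ∀ {m} n → Injective _≡_ _≡_ (remQuot {m} n)
remQuot-injective {m} n {x} {y} eq =
  trans (sym (combine-remQuot {m} n x)) (trans (cong (uncurry combine) eq) (combine-remQuot {m} n y))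

record BlockPacking {k n} (f : ℕ) (H : PartiteKGraph k n) : Set where
  field
    r                : ℕ
    vertex           : Fin r → Fin k → Fin f → Fin n
    vertex-injective : ∀ {b b′ i a a′} → vertex b i a ≡ vertex b′ i a′ → b ≡ b′ × a ≡ a′
    block-complete   : ∀ b (h : Fin k → Fin f) → H (canonical (λ i → vertex b i (h i))) ≡ true

  packed : Fin k → Fin (r * f) → Fin n
  packed i x = vertex (proj₁ (remQuot {r} f x)) i (proj₂ (remQuot {r} f x))

  covered : Fin k → Fin n → Bool
  covered i v = anyᶠ (λ x → v ≡ᵇ packed i x)

  packed-injective : ∀ i → Injective _≡_ _≡_ (packed i)
  packed-injective i eq = remQuot-injective {r} f (×-≡,≡→≡ (vertex-injective eq))

  packed-combine : ∀ i b a → packed i (combine b a) ≡ vertex b i a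
  packed-combine i b a = cong (λ (b , a) → vertex b i a) (remQuot-combine {r} {f} b a)

  covered-vertex : ∀ i b a → covered i (vertex b i a) ≡ true
  covered-vertex i b a = ⇒anyᶠ _ (combine b a) (≡⇒≡ᵇ (sym (packed-combine i b a)))

  count-uncovered : ∀ i → count (not ∘ covered i) (allFin n) + r * f ≡ n
  count-uncovered i = begin
    count (not ∘ covered i) (allFin n) + r * f
      ≡⟨ cong (count (not ∘ covered i) (allFin n) +_) (sym (count-image (packed i) (packed-injective i))) ⟩
    count (not ∘ covered i) (allFin n) + count (covered i) (allFin n)
      ≡⟨ count-not (covered i) (allFin n) ⟩
    length (allFin n) ≡⟨ length-tabulate (λ x → x) ⟩
    n ∎
    where open ≡-Reasoning

emptyPacking : ∀ {k n f} {H : PartiteKGraph k n} → BlockPacking f H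
emptyPacking = record { r = 0 ; vertex = λ () ; vertex-injective = λ { {()} } ; block-complete = λ () }

module PackingTiling {k f n} .{{_ : NonZero k}} (F : KGraph k f) (col : Fin f → Fin k)
  (col-partite : ∀ e → e ∈ edges F → ∀ j j′ → col (e j) ≡ col (e j′) → j ≡ j′)
  {H : PartiteKGraph k n} (P : BlockPacking f H) where

  open BlockPacking P
  open CyclicShift k

  -- Copy (b , j) puts the colour class c of F into part c ⊕ j of block b; as j ranges over
  -- Fin k, the k copies of block b use each of its vertices exactly once.
  copyAt : Fin r → Fin k → Fin f → Vertex k n
  copyAt b j a = col a ⊕ j , vertex b (col a ⊕ j) a

  copyAt-injective : ∀ b j → Injective _≡_ _≡_ (copyAt b j)
  copyAt-injective b j {a} {a′} eq with ×-≡,≡←≡ eq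
  ... | parts , same = proj₂ (vertex-injective (trans same (cong (λ i → vertex b i a′) (sym parts))))

  copyAt-disjoint : ∀ {b j b′ j′} a a′ → copyAt b j a ≡ copyAt b′ j′ a′ → (b , j) ≡ (b′ , j′)
  copyAt-disjoint {b} {j} {b′} {j′} a a′ eq with ×-≡,≡←≡ eq
  ... | parts , same with vertex-injective (trans same (cong (λ i → vertex b′ i a′) (sym parts)))
  ... | refl , refl = cong (b ,_) (⊕-cancelˡ (col a) parts)

  -- The vertex of e that copy j sends to part i; a part that e misses gets the junk value
  -- e i, which is harmless because the block is complete.
  vertexIn : (Fin k → Fin f) → Fin k → Fin k → Fin f
  vertexIn e j i with any? (λ j′ → col (e j′) ⊕ j ≟ i)
  ... | yes (j′ , _) = e j′
  ... | no  _        = e i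

  vertexIn-correct : ∀ {e} → e ∈ edges F → ∀ j j₀ → vertexIn e j (col (e j₀) ⊕ j) ≡ e j₀
  vertexIn-correct {e} e∈F j j₀ with any? (λ j′ → col (e j′) ⊕ j ≟ col (e j₀) ⊕ j)
  ... | yes (j′ , same) = cong e (col-partite e e∈F j′ j₀ (⊕-cancelʳ j same))
  ... | no  none        = contradiction (j₀ , refl) none

  copyAt-edge : ∀ b j e → e ∈ edges F → MapsToEdge H (copyAt b j) e
  copyAt-edge b j e e∈F = canonical x , block-complete b (vertexIn e j) , on-edge
    where
    x : Fin k → Fin n
    x i = vertex b i (vertexIn e j i)
    on-edge : ∀ j₀ → vertex b (col (e j₀) ⊕ j) (e j₀) ≡ canonical x (col (e j₀) ⊕ j)
    on-edge j₀ = sym (trans (canonical-≗ x _) (cong (vertex b _) (vertexIn-correct e∈F j j₀)))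

  tiling : Tiling F H
  tiling = record
    { m        = r * k
    ; copy     = copy′
    ; isCopy   = λ t → copyAt-injective _ _ , copyAt-edge _ _
    ; disjoint = λ t t′ a a′ eq → remQuot-injective {r} k (copyAt-disjoint a a′ eq)
    }
    where
    copy′ : Fin (r * k) → Fin f → Vertex k n
    copy′ t = uncurry copyAt (remQuot k t)

  covered-by-tiling⇔ : ∀ i v → (∃ λ t → ∃ λ a → copy tiling t a ≡ (i , v)) ⇔ T (covered i v)
  covered-by-tiling⇔ i v = mk⇔ to from
    where
    to : (∃ λ t → ∃ λ a → copy tiling t a ≡ (i , v)) → T (covered i v)
    to (t , a , eq) with ×-≡,≡←≡ eq
    ... | refl , refl = Equivalence.from T-≡
      (⇒anyᶠ _ (combine b a) (≡⇒≡ᵇ (sym (packed-combine (col a ⊕ j) b a))))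
      where
      b = proj₁ (remQuot {r} k t)
      j = proj₂ (remQuot {r} k t)
    from : T (covered i v) → ∃ λ t → ∃ λ a → copy tiling t a ≡ (i , v)
    from cov with anyᶠ⇒ _ (Equivalence.to T-≡ cov)
    ... | x , v≡x = combine b (i ⊖ col a) , a , goal
      where
      b = proj₁ (remQuot {r} f x)
      a = proj₂ (remQuot {r} f x)
      part : col a ⊕ (i ⊖ col a) ≡ i
      part = trans (⊕-comm (col a) _) (⊖-⊕ i (col a))
      goal : copy tiling (combine b (i ⊖ col a)) a ≡ (i , v)
      goal = begin
        copy tiling (combine b (i ⊖ col a)) a ≡⟨ cong (λ p → uncurry copyAt p a) (remQuot-combine b (i ⊖ col a)) ⟩
        copyAt b (i ⊖ col a) a                ≡⟨ cong (λ i′ → i′ , vertex b i′ a) part ⟩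
        i , vertex b i a                      ≡⟨ cong (i ,_) (sym (≡ᵇ⇒≡ v≡x)) ⟩
        i , v                                 ∎
        where open ≡-Reasoning

  uncovered-tiling : ∀ i → uncovered tiling i ≡ count (not ∘ covered i) (allFin n)
  uncovered-tiling i = trans (length-filter _ (allFin n)) (∑-cong (allFin n) λ v →
    cong (Bool→ℕ ∘ not) (does-⇔ (covered-by-tiling⇔ i v) (any? _) (T? (covered i v))))

-- Edge counts and densities

all-tabulate : ∀ {A : Set} {m} (p : A → Bool) (f : Fin m → A) → all p (tabulate f) ≡ allᶠ (p ∘ f)
all-tabulate {m = zero}  p f = refl
all-tabulate {m = suc m} p f = cong (p (f zero) ∧_) (all-tabulate p (f ∘ suc))

count-restricted : ∀ {n} k (P : Fin k → Fin n → Bool) (G : (Fin k → Fin n) → Bool) →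
  count (λ x → allᶠ (λ i → P i (x i)) ∧ G x) (allTuples k n) ≡ count G (tuplesIn (λ i → filterᵇ (P i) (allFin n)))
count-restricted         zero    P G = refl
count-restricted {n} (suc k) P G = begin
  count (λ x → allᶠ (λ i → P i (x i)) ∧ G x) (allTuples (suc k) n)
    ≡⟨ count-◂ _ (allFin n) (allTuples k n) ⟩
  ∑[ a ∈ allFin n ] count (λ y → (P zero a ∧ allᶠ (λ i → P (suc i) (y i))) ∧ G (a ◂ y)) (allTuples k n)
    ≡⟨ ∑-cong (allFin n) (λ a → trans (∑-cong (allTuples k n) (λ y → cong Bool→ℕ (∧-assoc (P zero a) _ _)))
                                      (count-∧ (P zero a) _ (allTuples k n))) ⟩
  ∑[ a ∈ allFin n ] Bool→ℕ (P zero a) * count (λ y → allᶠ (λ i → P (suc i) (y i)) ∧ G (a ◂ y)) (allTuples k n)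
    ≡⟨ ∑-cong (allFin n) (λ a → cong (Bool→ℕ (P zero a) *_) (count-restricted k (P ∘ suc) (λ y → G (a ◂ y)))) ⟩
  ∑[ a ∈ allFin n ] Bool→ℕ (P zero a) * count (λ y → G (a ◂ y)) Y
    ≡⟨ sym (∑-filterᵇ (P zero) _ (allFin n)) ⟩
  ∑[ a ∈ filterᵇ (P zero) (allFin n) ] count (λ y → G (a ◂ y)) Y
    ≡⟨ sym (count-tuplesIn G (λ i → filterᵇ (P i) (allFin n))) ⟩
  count G (tuplesIn (λ i → filterᵇ (P i) (allFin n))) ∎
  where
  open ≡-Reasoning
  Y = tuplesIn (λ i → filterᵇ (P (suc i)) (allFin n))

does-≟-true : ∀ b → does (b Bool.≟ true) ≡ b
does-≟-true true  = refl
does-≟-true false = refl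

eH-tabulate : ∀ {k n} (H : PartiteKGraph k n) (P : Fin k → Fin n → Bool) →
  eH H (λ i → Vec.tabulate (P i)) ≡ count H (tuplesIn (λ i → filterᵇ (P i) (allFin n)))
eH-tabulate {k} {n} H P = begin
  eH H X
    ≡⟨ length-filter _ (allTuples k n) ⟩
  count (λ x → does ((inX x ∧ H x) Bool.≟ true)) (allTuples k n)
    ≡⟨ ∑-cong (allTuples k n) (λ x → cong Bool→ℕ (trans (does-≟-true _) (cong (_∧ H x) (inX≡allᶠ x)))) ⟩
  count (λ x → allᶠ (λ i → P i (x i)) ∧ H x) (allTuples k n)
    ≡⟨ count-restricted k P H ⟩
  count H (tuplesIn (λ i → filterᵇ (P i) (allFin n))) ∎
  where
  open ≡-Reasoning
  X : Fin k → Vec.Vec Bool n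
  X i = Vec.tabulate (P i)
  inX : (Fin k → Fin n) → Bool
  inX x = all (λ i → Vec.lookup (X i) (x i)) (allFin k)
  allᶠ-cong : ∀ {m} {q r : Fin m → Bool} → (∀ i → q i ≡ r i) → allᶠ q ≡ allᶠ r
  allᶠ-cong {zero}  q≗r = refl
  allᶠ-cong {suc m} q≗r = cong₂ _∧_ (q≗r zero) (allᶠ-cong (q≗r ∘ suc))
  inX≡allᶠ : ∀ x → inX x ≡ allᶠ (λ i → P i (x i))
  inX≡allᶠ x = trans (all-tabulate (λ i → Vec.lookup (X i) (x i)) (λ i → i))
                     (allᶠ-cong (λ i → lookup∘tabulate (P i) (x i)))

∑-allFin-suc : ∀ {n} (g : Fin (suc n) → ℕ) → ∑ (allFin (suc n)) g ≡ g zero + ∑ (allFin n) (g ∘ suc)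
∑-allFin-suc {n} g = cong (g zero +_)
  (trans (cong (λ xs → ∑ xs g) (sym (map-tabulate (λ i → i) suc))) (∑-map g suc (allFin n)))

∣tabulate∣ : ∀ {n} (P : Fin n → Bool) → ∣ Vec.tabulate P ∣ ≡ count P (allFin n)
∣tabulate∣ {zero}  P = refl
∣tabulate∣ {suc n} P = trans (head+tail (P zero)) (sym (∑-allFin-suc (Bool→ℕ ∘ P)))
  where
  head+tail : ∀ b → ∣ b Vec.∷ Vec.tabulate (P ∘ suc) ∣ ≡ Bool→ℕ b + count (P ∘ suc) (allFin n)
  head+tail true  = cong suc (∣tabulate∣ (P ∘ suc))
  head+tail false = ∣tabulate∣ (P ∘ suc)

product-const : ∀ {k} (g : Fin k → ℕ) {u} → (∀ i → g i ≡ u) → product (map g (allFin k)) ≡ u ^ k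
product-const {zero}  g g≡u = refl
product-const {suc k} g g≡u = cong₂ _*_ (g≡u zero)
  (trans (cong product (trans (map-tabulate suc g) (sym (map-tabulate (λ i → i) (g ∘ suc)))))
         (product-const (g ∘ suc) (g≡u ∘ suc)))

ℕ→ℚ≡mkℚ : ∀ n → ℕ→ℚ n ≡ mkℚ (ℤ.+ n) 0 (Coprimality.sym (1-coprimeTo n))
ℕ→ℚ≡mkℚ n = ℚₚ.↥p/↧p≡p (mkℚ (ℤ.+ n) 0 (Coprimality.sym (1-coprimeTo n)))

ℕ→ℚ-mono-≤ : ∀ {m n} → m ≤ n → ℕ→ℚ m ℚ.≤ ℕ→ℚ n
ℕ→ℚ-mono-≤ {m} {n} m≤n rewrite ℕ→ℚ≡mkℚ m | ℕ→ℚ≡mkℚ n =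
  *≤* (subst₂ ℤ._≤_ (sym (ℤₚ.*-identityʳ (ℤ.+ m))) (sym (ℤₚ.*-identityʳ (ℤ.+ n))) (ℤ.+≤+ m≤n))

ℕ→ℚ-cancel-≤ : ∀ {m n} → ℕ→ℚ m ℚ.≤ ℕ→ℚ n → m ≤ n
ℕ→ℚ-cancel-≤ {m} {n} m≤n rewrite ℕ→ℚ≡mkℚ m | ℕ→ℚ≡mkℚ n with m≤n
... | *≤* m*1≤n*1 with subst₂ ℤ._≤_ (ℤₚ.*-identityʳ (ℤ.+ m)) (ℤₚ.*-identityʳ (ℤ.+ n)) m*1≤n*1
... | ℤ.+≤+ m≤n′ = m≤n′

ℕ→ℚ-nonNeg : ∀ n → NonNegative (ℕ→ℚ n)
ℕ→ℚ-nonNeg n = nonNegative (subst (ℚ._≤ ℕ→ℚ n) (ℕ→ℚ≡mkℚ 0) (ℕ→ℚ-mono-≤ {0} {n} z≤n))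

toℚᵘ-ℕ→ℚ : ∀ n → toℚᵘ (ℕ→ℚ n) ≃ mkℚᵘ (ℤ.+ n) 0
toℚᵘ-ℕ→ℚ n rewrite ℕ→ℚ≡mkℚ n = ℚᵘₚ.≃-refl

ℕ→ℚ-+ : ∀ m n → ℕ→ℚ (m + n) ≡ ℕ→ℚ m ℚ.+ ℕ→ℚ n
ℕ→ℚ-+ m n = ℚₚ.toℚᵘ-injective (ℚᵘₚ.≃-trans (toℚᵘ-ℕ→ℚ (m + n)) (ℚᵘₚ.≃-trans unnormalised (ℚᵘₚ.≃-sym
  (ℚᵘₚ.≃-trans (ℚₚ.toℚᵘ-homo-+ (ℕ→ℚ m) (ℕ→ℚ n)) (ℚᵘₚ.+-cong (toℚᵘ-ℕ→ℚ m) (toℚᵘ-ℕ→ℚ n))))))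
  where
  unnormalised : mkℚᵘ (ℤ.+ (m + n)) 0 ≃ mkℚᵘ (ℤ.+ m) 0 ℚᵘ.+ mkℚᵘ (ℤ.+ n) 0
  unnormalised = *≡* (trans (ℤₚ.*-identityʳ _) (trans (ℤₚ.pos-+ m n)
    (trans (cong₂ ℤ._+_ (sym (ℤₚ.*-identityʳ (ℤ.+ m))) (sym (ℤₚ.*-identityʳ (ℤ.+ n)))) (sym (ℤₚ.*-identityʳ _)))))

ℕ→ℚ-* : ∀ m n → ℕ→ℚ (m * n) ≡ ℕ→ℚ m ℚ.* ℕ→ℚ n
ℕ→ℚ-* m n = ℚₚ.toℚᵘ-injective (ℚᵘₚ.≃-trans (toℚᵘ-ℕ→ℚ (m * n)) (ℚᵘₚ.≃-trans unnormalised (ℚᵘₚ.≃-sym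
  (ℚᵘₚ.≃-trans (ℚₚ.toℚᵘ-homo-* (ℕ→ℚ m) (ℕ→ℚ n)) (ℚᵘₚ.*-cong (toℚᵘ-ℕ→ℚ m) (toℚᵘ-ℕ→ℚ n))))))
  where
  unnormalised : mkℚᵘ (ℤ.+ (m * n)) 0 ≃ mkℚᵘ (ℤ.+ m) 0 ℚᵘ.* mkℚᵘ (ℤ.+ n) 0
  unnormalised = *≡* (trans (ℤₚ.*-identityʳ _) (trans (ℤₚ.pos-* m n) (sym (ℤₚ.*-identityʳ _))))

1/[1+_] : ℕ → ℚ
1/[1+ d ] = mkℚ (ℤ.+ 1) d (1-coprimeTo (suc d))

1/[1+d]>0 : ∀ d → 0ℚ ℚ.< 1/[1+ d ]
1/[1+d]>0 d = *<* (ℤ.+<+ (s≤s z≤n))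

1/[1+d]*[1+d]≡1 : ∀ d → 1/[1+ d ] ℚ.* ℕ→ℚ (suc d) ≡ 1ℚ
1/[1+d]*[1+d]≡1 d = ℚₚ.toℚᵘ-injective (ℚᵘₚ.≃-trans (ℚₚ.toℚᵘ-homo-* 1/[1+ d ] (ℕ→ℚ (suc d)))
  (ℚᵘₚ.≃-trans (ℚᵘₚ.*-cong (ℚᵘₚ.≃-refl {mkℚᵘ (ℤ.+ 1) d}) (toℚᵘ-ℕ→ℚ (suc d))) unnormalised))
  where
  unnormalised : mkℚᵘ (ℤ.+ 1) d ℚᵘ.* mkℚᵘ (ℤ.+ suc d) 0 ≃ mkℚᵘ (ℤ.+ 1) 0
  unnormalised = *≡* (trans (ℤₚ.*-identityʳ _) (trans (ℤₚ.*-identityˡ (ℤ.+ suc d))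
    (trans (cong (λ z → ℤ.+ suc z) (sym (*-identityʳ d))) (sym (ℤₚ.*-identityˡ _)))))

1/[1+denominator]≤ : ∀ p → 0ℚ ℚ.< p → 1/[1+ ℚ.denominator-1 p ] ℚ.≤ p
1/[1+denominator]≤ (mkℚ +[1+ a ] d _) _ =
  *≤* (ℤₚ.*-monoʳ-≤-nonNeg (ℤ.+ suc d) {ℤ.+ 1} {+[1+ a ]} (ℤ.+≤+ (s≤s z≤n)))
1/[1+denominator]≤ (mkℚ (ℤ.+ 0)    d _) (*<* (ℤ.+<+ ()))
1/[1+denominator]≤ (mkℚ -[1+ a ] d _) (*<* ())

≤-by-unit-fraction : ∀ w u n (ω : ℚ) → 1/[1+ w ] ℚ.≤ ω → suc w * u ≤ n → ℕ→ℚ u ℚ.≤ ω ℚ.* ℕ→ℚ n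
≤-by-unit-fraction w u n ω ε≤ω [1+w]u≤n = begin
  ℕ→ℚ u                          ≡⟨ sym (ℚₚ.*-identityˡ (ℕ→ℚ u)) ⟩
  1ℚ ℚ.* ℕ→ℚ u                   ≡⟨ cong (ℚ._* ℕ→ℚ u) (sym (1/[1+d]*[1+d]≡1 w)) ⟩
  ε ℚ.* ℕ→ℚ (suc w) ℚ.* ℕ→ℚ u     ≡⟨ ℚₚ.*-assoc ε (ℕ→ℚ (suc w)) (ℕ→ℚ u) ⟩
  ε ℚ.* (ℕ→ℚ (suc w) ℚ.* ℕ→ℚ u)   ≡⟨ cong (ε ℚ.*_) (sym (ℕ→ℚ-* (suc w) u)) ⟩
  ε ℚ.* ℕ→ℚ (suc w * u)          ≤⟨ ℚₚ.*-monoˡ-≤-nonNeg ε (ℕ→ℚ-mono-≤ [1+w]u≤n) ⟩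
  ε ℚ.* ℕ→ℚ n                    ≤⟨ ℚₚ.*-monoʳ-≤-nonNeg (ℕ→ℚ n) {{ℕ→ℚ-nonNeg n}} ε≤ω ⟩
  ω ℚ.* ℕ→ℚ n                    ∎
  where
  open ℚₚ.≤-Reasoning
  ε = 1/[1+ w ]

density-in-ℕ : ∀ d q A B E {p μ : ℚ} → 1/[1+ d ] ℚ.≤ p → μ ℚ.≤ 1/[1+ q ] →
  p ℚ.* ℕ→ℚ A ℚ.- μ ℚ.* ℕ→ℚ B ℚ.≤ ℕ→ℚ E →
  suc q * A ≤ suc d * suc q * E + suc d * B
density-in-ℕ d q A B E {p} {μ} p≥ε μ≤δ pA-μB≤E = ℕ→ℚ-cancel-≤ (begin
  ℕ→ℚ (suc q * A)                      ≡⟨ ℕ→ℚ-* (suc q) A ⟩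
  Q ℚ.* a                              ≡⟨ Qa≡K[εa] ⟩
  K ℚ.* (ε ℚ.* a)                      ≤⟨ ℚₚ.*-monoˡ-≤-nonNeg K {{K-nonNeg}} εa≤e+δb ⟩
  K ℚ.* (e ℚ.+ δ ℚ.* b)                ≡⟨ K[e+δb]≡Ke+Db ⟩
  K ℚ.* e ℚ.+ D ℚ.* b                  ≡⟨ sym (cong₂ ℚ._+_ Ke≡ (ℕ→ℚ-* (suc d) B)) ⟩
  ℕ→ℚ (suc d * suc q * E) ℚ.+ ℕ→ℚ (suc d * B) ≡⟨ sym (ℕ→ℚ-+ (suc d * suc q * E) (suc d * B)) ⟩
  ℕ→ℚ (suc d * suc q * E + suc d * B)  ∎)
  where
  open +-*-Solver
  open ℚₚ.≤-Reasoning
  a = ℕ→ℚ A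
  b = ℕ→ℚ B
  e = ℕ→ℚ E
  D = ℕ→ℚ (suc d)
  Q = ℕ→ℚ (suc q)
  ε = 1/[1+ d ]
  δ = 1/[1+ q ]
  K = D ℚ.* Q
  K-nonNeg : NonNegative K
  K-nonNeg = subst NonNegative (ℕ→ℚ-* (suc d) (suc q)) (ℕ→ℚ-nonNeg (suc d * suc q))
  Qa≡K[εa] : Q ℚ.* a ≡ K ℚ.* (ε ℚ.* a)
  Qa≡K[εa] = trans (sym (ℚₚ.*-identityˡ (Q ℚ.* a))) (trans (cong (ℚ._* (Q ℚ.* a)) (sym (1/[1+d]*[1+d]≡1 d)))
    (solve 4 (λ ε D Q a → (ε :* D) :* (Q :* a) := (D :* Q) :* (ε :* a)) refl ε D Q a))
  K[e+δb]≡Ke+Db : K ℚ.* (e ℚ.+ δ ℚ.* b) ≡ K ℚ.* e ℚ.+ D ℚ.* b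
  K[e+δb]≡Ke+Db = trans
    (solve 5 (λ D Q e δ b → (D :* Q) :* (e :+ δ :* b) := (D :* Q) :* e :+ D :* ((δ :* Q) :* b)) refl D Q e δ b)
    (cong (λ z → K ℚ.* e ℚ.+ D ℚ.* z) (trans (cong (ℚ._* b) (1/[1+d]*[1+d]≡1 q)) (ℚₚ.*-identityˡ b)))
  Ke≡ : ℕ→ℚ (suc d * suc q * E) ≡ K ℚ.* e
  Ke≡ = trans (ℕ→ℚ-* (suc d * suc q) E) (cong (ℚ._* e) (ℕ→ℚ-* (suc d) (suc q)))
  εa≤e+δb : ε ℚ.* a ℚ.≤ e ℚ.+ δ ℚ.* b
  εa≤e+δb = begin
    ε ℚ.* a                           ≤⟨ ℚₚ.*-monoʳ-≤-nonNeg a {{ℕ→ℚ-nonNeg A}} p≥ε ⟩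
    p ℚ.* a                           ≡⟨ solve 3 (λ x y z → x := (x :+ (:- (y :* z))) :+ y :* z) refl (p ℚ.* a) μ b ⟩
    p ℚ.* a ℚ.- μ ℚ.* b ℚ.+ μ ℚ.* b   ≤⟨ ℚₚ.+-monoˡ-≤ (μ ℚ.* b) pA-μB≤E ⟩
    e ℚ.+ μ ℚ.* b                     ≤⟨ ℚₚ.+-monoʳ-≤ e (ℚₚ.*-monoʳ-≤-nonNeg b {{ℕ→ℚ-nonNeg B}} μ≤δ) ⟩
    e ℚ.+ δ ℚ.* b                     ∎

-- The greedy algorithm

module Greedy {k f′ n} .{{_ : NonZero k}} (H : PartiteKGraph k n) {p μ : ℚ} (dense : Dense p μ H)
  (d w q : ℕ) (p≥ : 1/[1+ d ] ℚ.≤ p) (μ≤ : μ ℚ.≤ 1/[1+ q ]) (q≥ : 2 * suc d * (k * suc w) ^ k ≤ q)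
  (n≥ : suc w * kstBound f′ k (2 * suc d) ≤ n) where

  open BlockPacking

  f = suc f′

  leftover : BlockPacking f H → ℕ
  leftover P = n ∸ r P * f

  count-uncovered≡leftover : ∀ P i → count (not ∘ covered P i) (allFin n) ≡ leftover P
  count-uncovered≡leftover P i =
    trans (sym (m+n∸n≡m _ (r P * f))) (cong (_∸ r P * f) (count-uncovered P i))

  uncoveredIn : BlockPacking f H → Fin k → List (Fin n)
  uncoveredIn P i = filterᵇ (not ∘ covered P i) (allFin n)

  module _ (P : BlockPacking f H) (not-done : n < suc w * leftover P) where

    private
      u = leftover P
      X = uncoveredIn P
      E = count H (tuplesIn X)

    ∣uncoveredIn∣ : ∀ i → length (X i) ≡ u
    ∣uncoveredIn∣ i = trans (length-filter _ (allFin n)) (count-uncovered≡leftover P i)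

    private
      B = (k * n) ^ k

      density : suc q * u ^ k ≤ suc d * suc q * E + suc d * B
      density = density-in-ℕ d q (u ^ k) B E p≥ μ≤
        (subst₂ (λ A e → p ℚ.* ℕ→ℚ A ℚ.- μ ℚ.* ℕ→ℚ B ℚ.≤ ℕ→ℚ e)
          (product-const _ (λ i → trans (∣tabulate∣ (not ∘ covered P i)) (count-uncovered≡leftover P i)))
          (eH-tabulate H (λ i → not ∘ covered P i))
          (dense (λ i → Vec.tabulate (not ∘ covered P i))))

      error-small : 2 * (suc d * B) ≤ suc q * u ^ k
      error-small = begin
        2 * (suc d * B)                     ≤⟨ *-monoʳ-≤ 2 (*-monoʳ-≤ (suc d) (^-monoˡ-≤ k (*-monoʳ-≤ k (<⇒≤ not-done)))) ⟩
        2 * (suc d * (k * (suc w * u)) ^ k) ≡⟨ cong (λ x → 2 * (suc d * x)) (cong (_^ k) (sym (*-assoc k (suc w) u))) ⟩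
        2 * (suc d * (k * suc w * u) ^ k)   ≡⟨ cong (λ x → 2 * (suc d * x)) (^-distribʳ-* k (k * suc w) u) ⟩
        2 * (suc d * ((k * suc w) ^ k * u ^ k)) ≡⟨ regroup (suc d) ((k * suc w) ^ k) (u ^ k) ⟩
        2 * suc d * (k * suc w) ^ k * u ^ k ≤⟨ *-monoˡ-≤ (u ^ k) (≤-trans q≥ (n≤1+n q)) ⟩
        suc q * u ^ k                       ∎
        where
        open ≤-Reasoning
        regroup : ∀ D K U → 2 * (D * (K * U)) ≡ 2 * D * K * U
        regroup = solve-∀

    uncovered-dense : u ^ k ≤ 2 * suc d * E
    uncovered-dense = *-cancelˡ-≤ (suc q) (+-cancelʳ-≤ (suc q * u ^ k) _ _ (begin
      suc q * u ^ k + suc q * u ^ k          ≡⟨ double (suc q * u ^ k) ⟩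
      2 * (suc q * u ^ k)                    ≤⟨ *-monoʳ-≤ 2 density ⟩
      2 * (suc d * suc q * E + suc d * B)    ≡⟨ expand (suc q) E (suc d) B ⟩
      suc q * (2 * suc d * E) + 2 * (suc d * B) ≤⟨ +-monoʳ-≤ (suc q * (2 * suc d * E)) error-small ⟩
      suc q * (2 * suc d * E) + suc q * u ^ k ∎))
      where
      open ≤-Reasoning
      double : ∀ a → a + a ≡ 2 * a
      double = solve-∀
      expand : ∀ Q E D B → 2 * (D * Q * E + D * B) ≡ Q * (2 * D * E) + 2 * (D * B)
      expand = solve-∀

    uncovered-complete : CompletePartite f′ X H
    uncovered-complete = complete-partite-subgraph f′ k (2 * suc d) u X H
      (λ i → filter⁺ _ (allFin⁺ n)) (≤-reflexive ∘ ∣uncoveredIn∣) uncovered-dense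
      (<⇒≤ (*-cancelˡ-< (suc w) _ _ (≤-<-trans n≥ not-done)))

    extend : Σ (BlockPacking f H) λ P′ → r P′ ≡ suc (r P)
    extend = record
      { r                = suc (r P)
      ; vertex           = vertex′
      ; vertex-injective = vertex′-injective _ _
      ; block-complete   = λ { zero → complete ; (suc b) → block-complete P b }
      } , refl
      where
      open CompletePartite uncovered-complete
      vertex′ : Fin (suc (r P)) → Fin k → Fin f → Fin n
      vertex′ zero    = part
      vertex′ (suc b) = vertex P b
      fresh : ∀ {i a b a′} → part i a ≢ vertex P b i a′
      fresh {i} {a} {b} {a′} eq = subst (T ∘ not) (trans (cong (covered P i) eq) (covered-vertex P i b a′))
                                        (proj₂ (∈-filter⁻ (T? ∘ not ∘ covered P i) {xs = allFin n} (part-∈ i a)))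
      vertex′-injective : ∀ b b′ {i a a′} → vertex′ b i a ≡ vertex′ b′ i a′ → b ≡ b′ × a ≡ a′
      vertex′-injective zero    zero     eq = refl , part-injective _ eq
      vertex′-injective zero    (suc b′) eq = contradiction eq fresh
      vertex′-injective (suc b) zero     eq = contradiction (sym eq) fresh
      vertex′-injective (suc b) (suc b′) eq with vertex-injective P eq
      ... | refl , a≡a′ = refl , a≡a′

  leftover-positive : ∀ P → n < suc w * leftover P → 0 < leftover P
  leftover-positive P not-done =
    *-cancelˡ-< (suc w) 0 _ (subst (_< suc w * leftover P) (sym (*-zeroʳ (suc w))) (≤-<-trans z≤n not-done))

  leftover-shrinks : ∀ P P′ → r P′ ≡ suc (r P) → 0 < leftover P → leftover P′ < leftover P
  leftover-shrinks P P′ r′≡1+r u>0 = begin-strict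
    n ∸ r P′ * f           ≡⟨ cong (λ m → n ∸ m * f) r′≡1+r ⟩
    n ∸ (f + r P * f)      ≡⟨ cong (n ∸_) (+-comm f (r P * f)) ⟩
    n ∸ (r P * f + f)      ≡⟨ sym (∸-+-assoc n (r P * f) f) ⟩
    leftover P ∸ suc f′    <⟨ ∸-suc-< (leftover P) u>0 ⟩
    leftover P             ∎
    where
    open ≤-Reasoning
    ∸-suc-< : ∀ m {o} → 0 < m → m ∸ suc o < m
    ∸-suc-< (suc m) {o} _ = s≤s (m∸n≤m m o)

  exhaust : ∀ fuel (P : BlockPacking f H) → leftover P ≤ fuel →
    Σ (BlockPacking f H) λ P′ → suc w * leftover P′ ≤ n
  exhaust fuel P u≤fuel with suc w * leftover P ≤? n
  ... | yes done = P , done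
  exhaust zero       P u≤0      | no not-done = contradiction u≤0 (<⇒≱ (leftover-positive P (≰⇒> not-done)))
  exhaust (suc fuel) P u≤1+fuel | no not-done with extend P (≰⇒> not-done)
  ... | P′ , r′≡1+r = exhaust fuel P′
    (≤-pred (≤-trans (leftover-shrinks P P′ r′≡1+r (leftover-positive P (≰⇒> not-done))) u≤1+fuel))

lemma5p1 : (k f : ℕ) → k ≥ 2 → f ≥ 1 →
    (F : KGraph k f) → IsKPartite F →
    (p ω : ℚ) → 0ℚ ℚ.< p → p ℚ.< 1ℚ → 0ℚ ℚ.< ω → ω ℚ.< 1ℚ →
    Σ ℚ λ μ₀ → (0ℚ ℚ.< μ₀) ×
      ((μ : ℚ) → 0ℚ ℚ.< μ → μ ℚ.≤ μ₀ →
        Σ ℕ λ n₀ → (n : ℕ) → n ≥ n₀ →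
          (H : PartiteKGraph k n) → Dense p μ H →
          Σ (Tiling F H) λ T → (i : Fin k) → ℕ→ℚ (uncovered T i) ℚ.≤ ω ℚ.* ℕ→ℚ n)
lemma5p1 (suc (suc k)) (suc f′) (s≤s (s≤s _)) (s≤s _) F (col , col-partite) p ω p>0 _ ω>0 _ =
  1/[1+ q ] , 1/[1+d]>0 q , λ μ _ μ≤μ₀ → suc w * kstBound f′ K (2 * suc d) , λ n n≥n₀ H dense →
    let open Greedy {f′ = f′} H dense d w q (1/[1+denominator]≤ p p>0) μ≤μ₀ ≤-refl n≥n₀
        P , few-left = exhaust n emptyPacking (m∸n≤m n 0)
        open PackingTiling F col col-partite P
    in tiling , λ i → subst (λ u → ℕ→ℚ u ℚ.≤ ω ℚ.* ℕ→ℚ n)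
                            (sym (trans (uncovered-tiling i) (count-uncovered≡leftover P i)))
                            (≤-by-unit-fraction w _ n ω (1/[1+denominator]≤ ω ω>0) few-left)
  where
  K = suc (suc k)
  d = ℚ.denominator-1 p
  w = ℚ.denominator-1 ω
  -- μ ≤ 1/(1+q) makes μ (Kn)^K at most half of p u^K whenever u > n/(1+w).
  q = 2 * suc d * (K * suc w) ^ K
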